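{- Let $G$ be a finite simple cubic graph and let $X\subseteq V(G)$ be a near independent dominating set of $G$. Let $n_1(G[X])$ denote the number of vertices of degree exactly $1$ in the induced subgraph $G[X]$. Then $i(G) \le |X| + \frac{1}{2} n_1(G[X])$.
   Context: A dominating set of $G$ is a set $S\subseteq V(G)$ such that every vertex not in $S$ has a neighbor in $S$. A near independent dominating set is a dominating set $X$ such that the induced subgraph $G[X]$ has maximum degree at most $1$. The independent domination number $i(G)$ is the minimum size of a dominating set of $G$ that is also an independent set. A graph is cubic if every vertex has degree $3$. -}

module Defs where

open import Data.Nat using (ℕ; zero; suc; _+_; _*_; _≤_)
open import Data.Bool using (Bool; true; false; _∧_)
open import Data.Fin using (Fin)
open import Data.Fin.Subset using (Subset; _∈_; _∉_; ∣_∣; ⊤)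
open import Data.Fin.Subset using () renaming (_∩_ to _∩ₛ_)
open import Data.Vec using (Vec; tabulate; lookup)
open import Data.List using (List; filter; length)
open import Data.List using () renaming (allFin to allFinL)
open import Data.Product using (Σ; _×_; ∃)
open import Relation.Binary.PropositionalEquality using (_≡_)
open import Relation.Nullary using (¬_)
open import Relation.Nullary.Decidable using (Dec)
open import Data.Bool using (T)
open import Data.Bool.Properties using (T?)

record Graph (n : ℕ) : Set where
  field
    adj     : Fin n → Fin n → Bool
    sym     : ∀ u v → adj u v ≡ adj v u
    irrefl  : ∀ v → adj v v ≡ false
open Graph public

E : ∀ {n} → Graph n → Fin n → Fin n → Set
E G u v = adj G u v ≡ true

N : ∀ {n} → Graph n → Fin n → Subset n
N G v = tabulate (λ u → adj G v u)

deg : ∀ {n} → Graph n → Fin n → ℕ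
deg G v = ∣ N G v ∣

Cubic : ∀ {n} → Graph n → Set
Cubic G = ∀ v → deg G v ≡ 3

degIn : ∀ {n} → Graph n → Subset n → Fin n → ℕ
degIn G X v = ∣ N G v ∩ₛ X ∣

Dominating : ∀ {n} → Graph n → Subset n → Set
Dominating G S = ∀ v → v ∉ S → ∃ λ u → u ∈ S × E G u v

Independent : ∀ {n} → Graph n → Subset n → Set
Independent G S = ∀ u v → u ∈ S → v ∈ S → ¬ E G u v

IndependentDominating : ∀ {n} → Graph n → Subset n → Set
IndependentDominating G S = Independent G S × Dominating G S

NearIndependentDominating : ∀ {n} → Graph n → Subset n → Set
NearIndependentDominating G X =
  Dominating G X × (∀ v → v ∈ X → degIn G X v ≤ 1)

isDeg1In : ∀ {n} → Graph n → Subset n → Fin n → Bool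
isDeg1In G X v with lookup X v | degIn G X v
... | true | 1 = true
... | _    | _ = false

n₁ : ∀ {n} → Graph n → Subset n → ℕ
n₁ G X = ∣ tabulate (isDeg1In G X) ∣

{-# OPTIONS --safe #-}
-- G[X] is a matching M plus isolated vertices.  Keeping the isolated vertices and the lower
-- endpoint of each edge of M gives an independent set L with |L| + |M| = |X|, while
-- n₁(G[X]) = 2|M|.  Extend L greedily to an independent dominating set S.  Every added vertex
-- is undominated by L, so it lies outside X and is dominated by an upper endpoint of an edge
-- of M; in a cubic graph such an endpoint has at most two neighbours besides its partner.
-- Hence |S| ≤ |L| + 2|M| = |X| + n₁(G[X])/2.
module Submission where

open import Defs hiding (sym)
open import Data.Bool using (Bool; true; false; _∧_)
open import Data.Bool.Properties using (∧-zeroʳ) renaming (_≟_ to _≟ᵇ_)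
open import Data.Fin as Fin using (Fin) renaming (_<_ to _<ᶠ_)
open import Data.Fin.Properties using (any?; _≟_; <-cmp; <-asym) renaming (_<?_ to _<ᶠ?_)
open import Data.Fin.Subset using (Subset; _∈_; _∉_; _⊆_; _∩_; _∪_; ⁅_⁆; ∣_∣)
open import Data.Fin.Subset.Properties
open import Data.List using (List; []; _∷_; allFin)
open import Data.List.Membership.Propositional using () renaming (_∈_ to _∈ₗ_)
open import Data.List.Membership.Propositional.Properties using (∈-allFin)
open import Data.List.Relation.Unary.Any using () renaming (here to hereₗ; there to thereₗ)
open import Data.Nat using (ℕ; zero; suc; _+_; _*_; _≤_; _<_; z≤n; s≤s)
open import Data.Nat.Properties
  using (≤-trans; ≤-reflexive; ≤-antisym; ≤-pred; +-suc; +-mono-≤; +-monoʳ-≤; *-monoʳ-≤;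
         *-identityˡ; *-identityʳ; m≤m+n; +-*-semiring; module ≤-Reasoning)
open import Algebra.Properties.Semiring.Sum +-*-semiring
  using (sum; sum-cong-≗; ∑-comm; *-distribʳ-sum; sum-replicate-zero)
open import Data.Nat.Tactic.RingSolver using (solve-∀)
open import Data.Product using (∃; _×_; _,_; proj₁; proj₂)
open import Data.Sum using (_⊎_; inj₁; inj₂; [_,_]′; map₂)
open import Data.Vec using (_∷_; []; lookup; tabulate; here; there)
open import Data.Vec.Properties using (lookup∘tabulate; lookup-zipWith; []=⇒lookup; lookup⇒[]=)
open import Function using (_∘_; id)
open import Relation.Binary using (tri<; tri≈; tri>)
open import Relation.Binary.PropositionalEquality using (_≡_; refl; sym; trans; cong; subst)
open import Relation.Nullary using (¬_; yes; no; does; contradiction; ¬?)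
open import Relation.Nullary.Decidable using (Dec; _×-dec_; _⊎-dec_; dec-true)
open import Relation.Unary using (Pred; Decidable)

variable
  n : ℕ
  x y : Fin n
  p q : Subset n

∣p∪q∣≤∣p∣+∣q∣ : (p q : Subset n) → ∣ p ∪ q ∣ ≤ ∣ p ∣ + ∣ q ∣
∣p∪q∣≤∣p∣+∣q∣ []          []          = z≤n
∣p∪q∣≤∣p∣+∣q∣ (true ∷ p)  (t ∷ q)     =
  s≤s (≤-trans (∣p∪q∣≤∣p∣+∣q∣ p q) (+-monoʳ-≤ ∣ p ∣ (∣p∣≤∣x∷p∣ t q)))
∣p∪q∣≤∣p∣+∣q∣ (false ∷ p) (true ∷ q)  =
  ≤-trans (s≤s (∣p∪q∣≤∣p∣+∣q∣ p q)) (≤-reflexive (sym (+-suc ∣ p ∣ ∣ q ∣)))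
∣p∪q∣≤∣p∣+∣q∣ (false ∷ p) (false ∷ q) = ∣p∪q∣≤∣p∣+∣q∣ p q

disjoint-∷ : ∀ {s t} → (∀ {x} → x ∈ s ∷ p → x ∉ t ∷ q) → ∀ {x} → x ∈ p → x ∉ q
disjoint-∷ disjoint x∈p x∈q = disjoint (there x∈p) (there x∈q)

∣p∣+∣q∣≤∣p∪q∣ : (p q : Subset n) → (∀ {x} → x ∈ p → x ∉ q) → ∣ p ∣ + ∣ q ∣ ≤ ∣ p ∪ q ∣
∣p∣+∣q∣≤∣p∪q∣ []          []          _        = z≤n
∣p∣+∣q∣≤∣p∪q∣ (true ∷ p)  (true ∷ q)  disjoint = contradiction here (disjoint here)
∣p∣+∣q∣≤∣p∪q∣ (true ∷ p)  (false ∷ q) disjoint = s≤s (∣p∣+∣q∣≤∣p∪q∣ p q (disjoint-∷ disjoint))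
∣p∣+∣q∣≤∣p∪q∣ (false ∷ p) (true ∷ q)  disjoint =
  ≤-trans (≤-reflexive (+-suc ∣ p ∣ ∣ q ∣)) (s≤s (∣p∣+∣q∣≤∣p∪q∣ p q (disjoint-∷ disjoint)))
∣p∣+∣q∣≤∣p∪q∣ (false ∷ p) (false ∷ q) disjoint = ∣p∣+∣q∣≤∣p∪q∣ p q (disjoint-∷ disjoint)

x∈p⇒⁅x⁆⊆p : x ∈ p → ⁅ x ⁆ ⊆ p
x∈p⇒⁅x⁆⊆p {x = x} {p} x∈p y∈⁅x⁆ = subst (_∈ p) (sym (x∈⁅y⁆⇒x≡y x y∈⁅x⁆)) x∈p

∪-lub : ∀ {r} → p ⊆ r → q ⊆ r → p ∪ q ⊆ r
∪-lub {p = p} {q} p⊆r q⊆r x∈ = [ p⊆r , q⊆r ]′ (x∈p∪q⁻ p q x∈)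

∩-monoʳ-⊆ : (r : Subset n) → p ⊆ q → r ∩ p ⊆ r ∩ q
∩-monoʳ-⊆ {p = p} r p⊆q x∈ = x∈p∩q⁺ (p∩q⊆p r p x∈ , p⊆q (p∩q⊆q r p x∈))

x∈p⇒0<∣p∣ : x ∈ p → 0 < ∣ p ∣
x∈p⇒0<∣p∣ {x = x} x∈p = ≤-trans (≤-reflexive (sym (∣⁅x⁆∣≡1 x))) (p⊆q⇒∣p∣≤∣q∣ (x∈p⇒⁅x⁆⊆p x∈p))

∣p∣≤1⇒x≡y : ∣ p ∣ ≤ 1 → x ∈ p → y ∈ p → x ≡ y
∣p∣≤1⇒x≡y {x = x} {y} ∣p∣≤1 x∈p y∈p with x ≟ y
... | yes x≡y = x≡y
... | no  x≢y = contradiction 2≤1 λ { (s≤s ()) }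
  where
  2≤1 : 2 ≤ 1
  2≤1 = ≤-trans (s≤s (x∈p⇒0<∣p∣ (x∈p∧x≢y⇒x∈p-y y∈p (x≢y ∘ sym)))) (≤-trans (x∈p⇒∣p-x∣<∣p∣ x∈p) ∣p∣≤1)

∈tabulate⁺ : {f : Fin n → Bool} → f x ≡ true → x ∈ tabulate f
∈tabulate⁺ {x = x} {f} fx = lookup⇒[]= x (tabulate f) (trans (lookup∘tabulate f x) fx)

∈tabulate⁻ : {f : Fin n → Bool} → x ∈ tabulate f → f x ≡ true
∈tabulate⁻ {x = x} {f} x∈ = trans (sym (lookup∘tabulate f x)) ([]=⇒lookup x∈)

fromDec : ∀ {ℓ} {P : Pred (Fin n) ℓ} → Decidable P → Subset n
fromDec P? = tabulate (does ∘ P?)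

module _ {ℓ} {P : Pred (Fin n) ℓ} (P? : Decidable P) where

  ∈fromDec⁺ : P x → x ∈ fromDec P?
  ∈fromDec⁺ {x} Px = ∈tabulate⁺ (dec-true (P? x) Px)

  ∈fromDec⁻ : x ∈ fromDec P? → P x
  ∈fromDec⁻ {x} x∈ = witness (P? x) (∈tabulate⁻ x∈)
    where
    witness : {A : Set ℓ} (a? : Dec A) → does a? ≡ true → A
    witness (yes a) _ = a

toℕ : Bool → ℕ
toℕ true  = 1
toℕ false = 0

sum-mono-≤ : {f g : Fin n → ℕ} → (∀ i → f i ≤ g i) → sum f ≤ sum g
sum-mono-≤ {zero}  f≤g = z≤n
sum-mono-≤ {suc n} f≤g = +-mono-≤ (f≤g Fin.zero) (sum-mono-≤ (f≤g ∘ Fin.suc))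

∣p∣≡sum : (p : Subset n) → ∣ p ∣ ≡ sum (toℕ ∘ lookup p)
∣p∣≡sum []          = refl
∣p∣≡sum (true ∷ p)  = cong suc (∣p∣≡sum p)
∣p∣≡sum (false ∷ p) = ∣p∣≡sum p

sum-∧ : ∀ b (f : Fin n → Bool) → sum (λ i → toℕ (b ∧ f i)) ≡ toℕ b * sum (toℕ ∘ f)
sum-∧ {n} false f = sum-replicate-zero n
sum-∧     true  f = sym (*-identityˡ _)

E-sym : (G : Graph n) → E G x y → E G y x
E-sym {x = x} {y = y} G e = trans (Graph.sym G y x) e

E-irrefl : (G : Graph n) → ¬ E G x x
E-irrefl {x = x} G e = contradiction (trans (sym e) (irrefl G x)) λ ()

E⇒∈N : (G : Graph n) → E G x y → y ∈ N G x
E⇒∈N G = ∈tabulate⁺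

∣N∩p∣≡sum : (G : Graph n) (v : Fin n) (p : Subset n) →
  ∣ N G v ∩ p ∣ ≡ sum (λ u → toℕ (adj G v u ∧ lookup p u))
∣N∩p∣≡sum G v p = trans (∣p∣≡sum (N G v ∩ p)) (sum-cong-≗ λ u →
  cong toℕ (trans (lookup-zipWith _∧_ u (N G v) p) (cong (_∧ lookup p u) (lookup∘tabulate (adj G v) u))))

DominatedBy : Graph n → Subset n → Fin n → Set
DominatedBy G S v = ∃ λ u → u ∈ S × E G u v

dominatedBy? : (G : Graph n) (S : Subset n) → Decidable (DominatedBy G S)
dominatedBy? G S v = any? λ u → u ∈? S ×-dec (adj G u v ≟ᵇ true)

-- Double counting

edges : Graph n → Subset n → Subset n → ℕ
edges G A B = sum λ a → sum λ b → toℕ (lookup A a ∧ adj G a b ∧ lookup B b)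

edges≡sum-deg : (G : Graph n) (A B : Subset n) →
  edges G A B ≡ sum (λ a → toℕ (lookup A a) * ∣ N G a ∩ B ∣)
edges≡sum-deg G A B = sum-cong-≗ λ a →
  trans (sum-∧ (lookup A a) λ b → adj G a b ∧ lookup B b)
        (cong (toℕ (lookup A a) *_) (sym (∣N∩p∣≡sum G a B)))

edges-comm : (G : Graph n) (A B : Subset n) → edges G A B ≡ edges G B A
edges-comm G A B = trans (∑-comm λ a b → toℕ (lookup A a ∧ adj G a b ∧ lookup B b))
  (sum-cong-≗ λ b → sum-cong-≗ λ a → cong toℕ (trans (cong (λ e → lookup A a ∧ e ∧ lookup B b) (Graph.sym G a b))
                                                    (∧-reverse (lookup A a) _ (lookup B b))))
  where
  ∧-reverse : ∀ x y z → x ∧ y ∧ z ≡ z ∧ y ∧ x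
  ∧-reverse true  y true  = refl
  ∧-reverse true  y false = ∧-zeroʳ y
  ∧-reverse false y true  = sym (∧-zeroʳ y)
  ∧-reverse false y false = refl

∣A∣≤∣B∣*k : (G : Graph n) {A B : Subset n} (k : ℕ) →
  (∀ {a} → a ∈ A → DominatedBy G B a) → (∀ {b} → b ∈ B → ∣ N G b ∩ A ∣ ≤ k) → ∣ A ∣ ≤ ∣ B ∣ * k
∣A∣≤∣B∣*k G {A} {B} k dominated bounded = begin
  ∣ A ∣                                                ≡⟨ ∣p∣≡sum A ⟩
  sum (toℕ ∘ lookup A)                                 ≤⟨ sum-mono-≤ atLeastOne ⟩
  sum (λ a → toℕ (lookup A a) * ∣ N G a ∩ B ∣)         ≡⟨ sym (edges≡sum-deg G A B) ⟩
  edges G A B                                          ≡⟨ edges-comm G A B ⟩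
  edges G B A                                          ≡⟨ edges≡sum-deg G B A ⟩
  sum (λ b → toℕ (lookup B b) * ∣ N G b ∩ A ∣)         ≤⟨ sum-mono-≤ atMostK ⟩
  sum (λ b → toℕ (lookup B b) * k)                     ≡⟨ sym (*-distribʳ-sum k (toℕ ∘ lookup B)) ⟩
  sum (toℕ ∘ lookup B) * k                             ≡⟨ cong (_* k) (sym (∣p∣≡sum B)) ⟩
  ∣ B ∣ * k                                            ∎
  where
  open ≤-Reasoning
  atLeastOne : ∀ a → toℕ (lookup A a) ≤ toℕ (lookup A a) * ∣ N G a ∩ B ∣
  atLeastOne a with lookup A a in a∈A
  ... | false = z≤n
  ... | true with dominated (lookup⇒[]= a A a∈A)
  ...   | b , b∈B , Eba = ≤-trans (x∈p⇒0<∣p∣ (x∈p∩q⁺ (E⇒∈N G (E-sym G Eba) , b∈B))) (m≤m+n _ 0)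
  atMostK : ∀ b → toℕ (lookup B b) * ∣ N G b ∩ A ∣ ≤ toℕ (lookup B b) * k
  atMostK b with lookup B b in b∈B
  ... | false = z≤n
  ... | true  = *-monoʳ-≤ 1 (bounded (lookup⇒[]= b B b∈B))

-- Greedy extension of an independent set

Undominated : Graph n → Subset n → Fin n → Set
Undominated G B v = ¬ (v ∈ B ⊎ DominatedBy G B v)

undominated? : (G : Graph n) (B : Subset n) → Decidable (Undominated G B)
undominated? G B v = ¬? (v ∈? B ⊎-dec dominatedBy? G B v)

undominated : Graph n → Subset n → Subset n
undominated G B = fromDec (undominated? G B)

independent-∪⁅⁆ : (G : Graph n) {S : Subset n} → Independent G S → ¬ DominatedBy G S y →
  Independent G (S ∪ ⁅ y ⁆)
independent-∪⁅⁆ {y = y} G {S} S-indep ¬dom u v u∈ v∈ Euv with x∈p∪q⁻ S ⁅ y ⁆ u∈ | x∈p∪q⁻ S ⁅ y ⁆ v∈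
... | inj₁ u∈S | inj₁ v∈S = S-indep u v u∈S v∈S Euv
... | inj₁ u∈S | inj₂ v∈y with refl ← x∈⁅y⁆⇒x≡y y v∈y = ¬dom (u , u∈S , Euv)
... | inj₂ u∈y | inj₁ v∈S with refl ← x∈⁅y⁆⇒x≡y y u∈y = ¬dom (v , v∈S , E-sym G Euv)
... | inj₂ u∈y | inj₂ v∈y with refl ← x∈⁅y⁆⇒x≡y y u∈y | refl ← x∈⁅y⁆⇒x≡y y v∈y = E-irrefl G Euv

module Greedy (G : Graph n) {B : Subset n} (B-indep : Independent G B) where

  record Partial (L : List (Fin n)) : Set where
    field
      S         : Subset n
      S-indep   : Independent G S
      B⊆S       : B ⊆ S
      S⊆B∪U     : S ⊆ B ∪ undominated G B
      dominates : ∀ {v} → v ∈ₗ L → v ∉ S → DominatedBy G S v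

  start : Partial []
  start = record { S = B ; S-indep = B-indep ; B⊆S = id ; S⊆B∪U = p⊆p∪q _ ; dominates = λ () }

  step : ∀ {L} y → Partial L → Partial (y ∷ L)
  step {L} y P = extend (y ∈? S) (dominatedBy? G S y)
    where
    open Partial P
    keep : (y ∉ S → DominatedBy G S y) → Partial (y ∷ L)
    keep covered = record
      { S = S ; S-indep = S-indep ; B⊆S = B⊆S ; S⊆B∪U = S⊆B∪U
      ; dominates = λ { (hereₗ refl) → covered ; (thereₗ v∈L) → dominates v∈L } }
    extend : Dec (y ∈ S) → Dec (DominatedBy G S y) → Partial (y ∷ L)
    extend (yes y∈S) _            = keep λ y∉S → contradiction y∈S y∉S
    extend (no _)    (yes y-dom)  = keep λ _ → y-dom
    extend (no y∉S) (no y-undom) = record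
      { S         = S ∪ ⁅ y ⁆
      ; S-indep   = independent-∪⁅⁆ G S-indep y-undom
      ; B⊆S       = p⊆p∪q _ ∘ B⊆S
      ; S⊆B∪U     = ∪-lub S⊆B∪U (q⊆p∪q B _ ∘ x∈p⇒⁅x⁆⊆p y∈U)
      ; dominates = λ { (hereₗ refl) y∉S∪y → contradiction (q⊆p∪q S _ (x∈⁅x⁆ y)) y∉S∪y
                      ; (thereₗ v∈L) v∉S∪y → let (u , u∈S , Euv) = dominates v∈L (v∉S∪y ∘ p⊆p∪q _)
                                              in u , p⊆p∪q _ u∈S , Euv }
      }
      where
      y∈U : y ∈ undominated G B
      y∈U = ∈fromDec⁺ (undominated? G B) λ { (inj₁ y∈B) → y∉S (B⊆S y∈B)
                          ; (inj₂ (u , u∈B , Euy)) → y-undom (u , B⊆S u∈B , Euy) }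

  run : ∀ L → Partial L
  run []      = start
  run (y ∷ L) = step y (run L)

extend-to-independent-dominating : (G : Graph n) {B : Subset n} → Independent G B →
  ∃ λ S → IndependentDominating G S × S ⊆ B ∪ undominated G B
extend-to-independent-dominating {n} G B-indep = S , (S-indep , λ v → dominates (∈-allFin v)) , S⊆B∪U
  where open Greedy.Partial (Greedy.run G B-indep (allFin n))

isDeg1In-true : (G : Graph n) (X : Subset n) {v : Fin n} →
  lookup X v ≡ true → degIn G X v ≡ 1 → isDeg1In G X v ≡ true
isDeg1In-true G X v∈X deg≡1 rewrite v∈X | deg≡1 = refl

module NearIndependent (G : Graph n) (X : Subset n) (X-deg≤1 : ∀ v → v ∈ X → degIn G X v ≤ 1) where

  X-neighbour-unique : {v u w : Fin n} → v ∈ X → u ∈ X → w ∈ X → E G v u → E G v w → u ≡ w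
  X-neighbour-unique {v} v∈X u∈X w∈X Evu Evw =
    ∣p∣≤1⇒x≡y (X-deg≤1 v v∈X) (x∈p∩q⁺ (E⇒∈N G Evu , u∈X)) (x∈p∩q⁺ (E⇒∈N G Evw , w∈X))

  HasLowerNeighbour : Fin n → Set
  HasLowerNeighbour v = ∃ λ u → u <ᶠ v × u ∈ X × E G u v

  hasLowerNeighbour? : Decidable HasLowerNeighbour
  hasLowerNeighbour? v = any? λ u → u <ᶠ? v ×-dec u ∈? X ×-dec adj G u v ≟ᵇ true

  -- The leaders are the isolated vertices of G[X] and the lower endpoint of each of its edges,
  -- the followers the upper endpoints.
  leaders followers : Subset n
  leaders   = X ∩ fromDec (¬? ∘ hasLowerNeighbour?)
  followers = X ∩ fromDec hasLowerNeighbour?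

  ∈leaders⁻ : {v : Fin n} → v ∈ leaders → v ∈ X × ¬ HasLowerNeighbour v
  ∈leaders⁻ v∈ with x∈p∩q⁻ X _ v∈
  ... | v∈X , v∈T = v∈X , ∈fromDec⁻ (¬? ∘ hasLowerNeighbour?) v∈T

  ∈followers⁻ : {v : Fin n} → v ∈ followers → v ∈ X × HasLowerNeighbour v
  ∈followers⁻ v∈ with x∈p∩q⁻ X _ v∈
  ... | v∈X , v∈T = v∈X , ∈fromDec⁻ hasLowerNeighbour? v∈T

  leaders⊆X : leaders ⊆ X
  leaders⊆X = proj₁ ∘ ∈leaders⁻

  followers⊆X : followers ⊆ X
  followers⊆X = proj₁ ∘ ∈followers⁻

  leader⇒¬follower : {v : Fin n} → v ∈ leaders → v ∉ followers
  leader⇒¬follower v∈L v∈F = proj₂ (∈leaders⁻ v∈L) (proj₂ (∈followers⁻ v∈F))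

  ∈X⇒leader⊎follower : {v : Fin n} → v ∈ X → v ∈ leaders ⊎ v ∈ followers
  ∈X⇒leader⊎follower {v} v∈X with hasLowerNeighbour? v
  ... | yes lower = inj₂ (x∈p∩q⁺ (v∈X , ∈fromDec⁺ hasLowerNeighbour? lower))
  ... | no ¬lower = inj₁ (x∈p∩q⁺ (v∈X , ∈fromDec⁺ (¬? ∘ hasLowerNeighbour?) ¬lower))

  leaders-independent : Independent G leaders
  leaders-independent u v u∈ v∈ Euv with <-cmp u v
  ... | tri< u<v _ _  = proj₂ (∈leaders⁻ v∈) (u , u<v , leaders⊆X u∈ , Euv)
  ... | tri≈ _ refl _ = E-irrefl G Euv
  ... | tri> _ _ v<u  = proj₂ (∈leaders⁻ u∈) (v , v<u , leaders⊆X v∈ , E-sym G Euv)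

  -- The lower neighbour u of a follower v is a leader: a neighbour of u below u would be a
  -- second X-neighbour of u besides v.
  follower-dominated-by-leader : {v : Fin n} → v ∈ followers → DominatedBy G leaders v
  follower-dominated-by-leader v∈ with ∈followers⁻ v∈
  ... | v∈X , u , u<v , u∈X , Euv = u , x∈p∩q⁺ (u∈X , ∈fromDec⁺ (¬? ∘ hasLowerNeighbour?) ¬lower) , Euv
    where
    ¬lower : ¬ HasLowerNeighbour u
    ¬lower (w , w<u , w∈X , Ewu) with X-neighbour-unique u∈X v∈X w∈X Euv (E-sym G Ewu)
    ... | refl = <-asym u<v w<u

  ∣leaders∣+∣followers∣≤∣X∣ : ∣ leaders ∣ + ∣ followers ∣ ≤ ∣ X ∣
  ∣leaders∣+∣followers∣≤∣X∣ = ≤-trans (∣p∣+∣q∣≤∣p∪q∣ leaders followers leader⇒¬follower)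
                                      (p⊆q⇒∣p∣≤∣q∣ (∪-lub leaders⊆X followers⊆X))

  degreeOne : Subset n
  degreeOne = tabulate (isDeg1In G X)

  X-neighbour⇒degreeOne : {v u : Fin n} → v ∈ X → u ∈ X → E G v u → v ∈ degreeOne
  X-neighbour⇒degreeOne {v} v∈X u∈X Evu = ∈tabulate⁺ (isDeg1In-true G X ([]=⇒lookup v∈X)
    (≤-antisym (X-deg≤1 v v∈X) (x∈p⇒0<∣p∣ (x∈p∩q⁺ (E⇒∈N G Evu , u∈X)))))

  -- Each follower and its leader neighbour are both counted by n₁, and distinct followers
  -- have distinct leader neighbours.
  ∣followers∣+∣followers∣≤n₁ : ∣ followers ∣ + ∣ followers ∣ ≤ n₁ G X
  ∣followers∣+∣followers∣≤n₁ = begin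
    ∣ followers ∣ + ∣ followers ∣ ≤⟨ +-monoʳ-≤ ∣ followers ∣ ∣followers∣≤∣Q∣ ⟩
    ∣ followers ∣ + ∣ Q ∣         ≤⟨ ∣p∣+∣q∣≤∣p∪q∣ followers Q (λ v∈F v∈Q → leader⇒¬follower (Q⊆leaders v∈Q) v∈F) ⟩
    ∣ followers ∪ Q ∣             ≤⟨ p⊆q⇒∣p∣≤∣q∣ (∪-lub followers⊆degreeOne (p∩q⊆q leaders degreeOne)) ⟩
    ∣ degreeOne ∣                 ∎
    where
    open ≤-Reasoning
    Q : Subset n
    Q = leaders ∩ degreeOne
    Q⊆leaders : Q ⊆ leaders
    Q⊆leaders = p∩q⊆p leaders degreeOne
    followers⊆degreeOne : followers ⊆ degreeOne
    followers⊆degreeOne v∈F with follower-dominated-by-leader v∈F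
    ... | u , u∈L , Euv = X-neighbour⇒degreeOne (followers⊆X v∈F) (leaders⊆X u∈L) (E-sym G Euv)
    dominated : ∀ {v} → v ∈ followers → DominatedBy G Q v
    dominated v∈F with follower-dominated-by-leader v∈F
    ... | u , u∈L , Euv = u , x∈p∩q⁺ (u∈L , X-neighbour⇒degreeOne (leaders⊆X u∈L) (followers⊆X v∈F) Euv) , Euv
    bounded : ∀ {b} → b ∈ Q → ∣ N G b ∩ followers ∣ ≤ 1
    bounded {b} b∈Q = ≤-trans (p⊆q⇒∣p∣≤∣q∣ (∩-monoʳ-⊆ (N G b) followers⊆X)) (X-deg≤1 b (leaders⊆X (Q⊆leaders b∈Q)))
    ∣followers∣≤∣Q∣ : ∣ followers ∣ ≤ ∣ Q ∣
    ∣followers∣≤∣Q∣ = ≤-trans (∣A∣≤∣B∣*k G 1 dominated bounded) (≤-reflexive (*-identityʳ ∣ Q ∣))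

  module _ (cubic : Cubic G) (X-dominating : Dominating G X) where

    -- A vertex undominated by the leaders lies outside X, and its X-neighbours are followers.
    undominated-dominated-by-followers : {w : Fin n} → w ∈ undominated G leaders →
                                         DominatedBy G followers w
    undominated-dominated-by-followers {w} w∈U = byFollower (X-dominating w w∉X)
      where
      w-undom : Undominated G leaders w
      w-undom = ∈fromDec⁻ (undominated? G leaders) w∈U
      w∉X : w ∉ X
      w∉X w∈X = w-undom (map₂ follower-dominated-by-leader (∈X⇒leader⊎follower w∈X))
      byFollower : DominatedBy G X w → DominatedBy G followers w
      byFollower (y , y∈X , Eyw) with ∈X⇒leader⊎follower y∈X
      ... | inj₁ y∈L = contradiction (inj₂ (y , y∈L , Eyw)) w-undom
      ... | inj₂ y∈F = y , y∈F , Eyw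

    -- One of the three neighbours of a follower is a leader.
    ∣N∩undominated∣≤2 : {v : Fin n} → v ∈ followers → ∣ N G v ∩ undominated G leaders ∣ ≤ 2
    ∣N∩undominated∣≤2 {v} v∈F with follower-dominated-by-leader v∈F
    ... | u , u∈L , Euv = ≤-pred (begin-strict
      ∣ N G v ∩ undominated G leaders ∣ <⟨ p⊂q⇒∣p∣<∣q∣ (p∩q⊆p _ _ , u , E⇒∈N G (E-sym G Euv) , u∉) ⟩
      ∣ N G v ∣                         ≡⟨ cubic v ⟩
      3                                 ∎)
      where
      open ≤-Reasoning
      u∉ : u ∉ N G v ∩ undominated G leaders
      u∉ u∈ = ∈fromDec⁻ (undominated? G leaders) (p∩q⊆q (N G v) _ u∈) (inj₁ u∈L)

    ∣undominated∣≤∣followers∣*2 : ∣ undominated G leaders ∣ ≤ ∣ followers ∣ * 2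
    ∣undominated∣≤∣followers∣*2 = ∣A∣≤∣B∣*k G 2 undominated-dominated-by-followers ∣N∩undominated∣≤2

combine-bounds : ∀ {s l u f x d} → s ≤ l + u → u ≤ f * 2 → l + f ≤ x → f + f ≤ d → 2 * s ≤ 2 * x + d
combine-bounds {s} {l} {u} {f} {x} {d} s≤ u≤ lf≤ ff≤ = begin
  2 * s                   ≤⟨ *-monoʳ-≤ 2 (≤-trans s≤ (+-monoʳ-≤ l u≤)) ⟩
  2 * (l + f * 2)         ≡⟨ regroup l f ⟩
  2 * (l + f) + (f + f)   ≤⟨ +-mono-≤ (*-monoʳ-≤ 2 lf≤) ff≤ ⟩
  2 * x + d               ∎
  where
  open ≤-Reasoning
  regroup : ∀ l f → 2 * (l + f * 2) ≡ 2 * (l + f) + (f + f)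
  regroup = solve-∀

lemma3p1 : ∀ {n} (G : Graph n) → Cubic G → (X : Subset n) → NearIndependentDominating G X →
    ∃ λ S → IndependentDominating G S × 2 * ∣ S ∣ ≤ 2 * ∣ X ∣ + n₁ G X
lemma3p1 G cubic X (X-dominating , X-deg≤1) =
  let S , S-indep-dom , S⊆leaders∪undominated = extend-to-independent-dominating G leaders-independent
  in S , S-indep-dom , combine-bounds
       (≤-trans (p⊆q⇒∣p∣≤∣q∣ S⊆leaders∪undominated) (∣p∪q∣≤∣p∣+∣q∣ leaders _))
       (∣undominated∣≤∣followers∣*2 cubic X-dominating)
       ∣leaders∣+∣followers∣≤∣X∣
       ∣followers∣+∣followers∣≤n₁
  where open NearIndependent G X X-deg≤1
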